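{- Let $t\ge1$ and let $G$ be a fixed group of order $4t+2$. Among the groups $E_\psi$, where $\psi$ ranges over the quasi-orthogonal cocycles in $Z^2(G,\langle-1\rangle)$, there are at most two isomorphism types.
   Context: A (normalized) cocycle is a map $\psi:G\times G\to\{\pm1\}$ with $\psi(g,h)\psi(gh,k)=\psi(g,hk)\psi(h,k)$ for all $g,h,k$ and $\psi(1,1)=1$; $Z^2(G,\langle-1\rangle)$ is the set of these. For an ordering $g_1=1,\dots,g_{4t+2}$ of $G$, $M_\psi=[\psi(g_i,g_j)]_{i,j}$; for an $n\times n$ $(\pm1)$-matrix $M$ with first row all $1$s, $RE(M)=\sum_{i=2}^n|\sum_j m_{i,j}|$; $\psi$ is quasi-orthogonal if $RE(M_\psi)=4t$. $E_\psi$ is the group with elements $\{(u,g):u\in\{\pm1\},g\in G\}$ and multiplication $(u,g)(v,h)=(uv\,\psi(g,h),gh)$. (By the paper's equivalence, these $E_\psi$ are exactly the quasi-Hadamard groups arising from quasi-orthogonal elements of $Z^2(G,\mathbb{Z}_2)$.) -}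

module Defs where

open import Data.Nat using (ℕ; zero; suc; _+_; _*_)
open import Data.Fin using (Fin; _≟_)
import Data.Fin as Fin
open import Data.Integer using (ℤ; ∣_∣; 1ℤ; -1ℤ) renaming (_+_ to _+ℤ_; _*_ to _*ℤ_)
import Data.Integer as ℤ
open import Data.Sign using (Sign) renaming (_*_ to _*ˢ_)
open import Data.Product using (Σ; _×_; _,_)
open import Relation.Binary.PropositionalEquality using (_≡_)
open import Relation.Nullary using (does)
open import Data.Bool using (if_then_else_)
open import Function.Definitions using (Bijective)

-- A finite group whose underlying set is Fin n (every group of order n is
-- isomorphic to one of these), with propositional equality.
record FinGroup (n : ℕ) : Set where
  field
    _∙_   : Fin n → Fin n → Fin n
    e     : Fin n
    inv   : Fin n → Fin n
    assoc : ∀ x y z → (x ∙ y) ∙ z ≡ x ∙ (y ∙ z)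
    idˡ   : ∀ x → e ∙ x ≡ x
    idʳ   : ∀ x → x ∙ e ≡ x
    invˡ  : ∀ x → inv x ∙ x ≡ e
    invʳ  : ∀ x → x ∙ inv x ≡ e

-- Values in ⟨-1⟩ = {±1} are represented by Data.Sign (+ ↦ 1, - ↦ -1).
signℤ : Sign → ℤ
signℤ Sign.+ = 1ℤ
signℤ Sign.- = -1ℤ

sumℤ : ∀ {n} → (Fin n → ℤ) → ℤ
sumℤ {zero}  f = ℤ.0ℤ
sumℤ {suc n} f = f Fin.zero +ℤ sumℤ (λ i → f (Fin.suc i))

sumℕ : ∀ {n} → (Fin n → ℕ) → ℕ
sumℕ {zero}  f = 0
sumℕ {suc n} f = f Fin.zero + sumℕ (λ i → f (Fin.suc i))

module _ {n : ℕ} (G : FinGroup n) where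
  open FinGroup G

  IsCocycle : (Fin n → Fin n → Sign) → Set
  IsCocycle ψ = (∀ g h k → ψ g h *ˢ ψ (g ∙ h) k ≡ ψ g (h ∙ k) *ˢ ψ h k)
              × ψ e e ≡ Sign.+

  -- RE(M_ψ) = Σ_{i ≥ 2} |Σ_j ψ(g_i,g_j)|, where g_1 = 1; the rows i ≥ 2
  -- are exactly the rows indexed by g ≠ e (the value is independent of
  -- the chosen ordering of G).
  RE : (Fin n → Fin n → Sign) → ℕ
  RE ψ = sumℕ (λ g → if does (g ≟ e) then 0
                       else ∣ sumℤ (λ h → signℤ (ψ g h)) ∣)

  Emul : (Fin n → Fin n → Sign) → Sign × Fin n → Sign × Fin n → Sign × Fin n
  Emul ψ (u , g) (v , h) = ((u *ˢ v) *ˢ ψ g h , g ∙ h)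

  EIso : (Fin n → Fin n → Sign) → (Fin n → Fin n → Sign) → Set
  EIso ψ φ = Σ (Sign × Fin n → Sign × Fin n) λ f →
               Bijective _≡_ _≡_ f × (∀ x y → f (Emul ψ x y) ≡ Emul φ (f x) (f y))

ord : ℕ → ℕ
ord t = 4 * t + 2

QuasiOrthogonal : ∀ t → FinGroup (ord t) → (Fin (ord t) → Fin (ord t) → Sign) → Set
QuasiOrthogonal t G ψ = IsCocycle G ψ × RE G ψ ≡ 4 * t

module Submission where

-- Since |G| = 2m with m = 2t+1 odd, a Sylow 2-subgroup of G is
-- H = {e, a} for an involution a, and the class of a cocycle ψ in
-- H²(G, {±1}) is determined by the single sign ψ(a,a).
-- Among three signs ψᵢ(a,a) two agree, which gives the corollary.

open import Defs
open import Level using (0ℓ)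
open import Data.Nat using (ℕ; zero; suc; _+_; _*_; _≥_)
open import Data.Nat.Properties using (+-0-commutativeMonoid; +-identityʳ; even≢odd) renaming (*-cancelˡ-≡ to ℕ-*-cancelˡ-≡)
open import Data.Nat.Tactic.RingSolver using (solve-∀)
open import Data.Fin using (Fin; _≟_; _<?_) renaming (zero to fzero; suc to fsuc)
open import Data.Fin.Properties using (<-cmp; any?)
open import Data.Fin.Permutation using (Permutation′; permutation)
open import Data.Bool using (Bool; true; false; not; if_then_else_)
open import Data.Bool.Properties using (¬-not; not-injective) renaming (_≟_ to _≟ᵇ_)
open import Data.Sign using (Sign) renaming (_*_ to _·_; + to s+; - to s-)
open import Data.Sign.Properties
  using (s*s≡+; *-assoc; *-identityʳ; *-cancelˡ-≡; *-cancelʳ-≡; *-monoid; *-commutativeSemigroup; *-commutativeMonoid)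
open import Data.Product using (Σ; _×_; _,_; proj₁; proj₂)
open import Data.Sum using (_⊎_; inj₁; inj₂; map)
open import Function using (_∘_)
open import Relation.Binary.PropositionalEquality
open import Relation.Binary.Definitions using (tri<; tri≈; tri>)
open import Relation.Nullary using (yes; no; does)
open import Relation.Nullary.Negation using (contradiction)
open import Relation.Nullary.Decidable using (dec-true; dec-false; ¬?; _×-dec_)
open import Algebra.Bundles using (Group)
import Algebra.Properties.Group as GroupProperties
import Algebra.Properties.CommutativeMonoid.Sum as CommutativeMonoidSum
open import Algebra.Properties.Monoid.Mult *-monoid using (×-homo-+) renaming (_×_ to _×ₛ_)
open import Algebra.Properties.CommutativeSemigroup *-commutativeSemigroup using (interchange)
open import Algebra.Solver.CommutativeMonoid *-commutativeMonoid using (solve; _⊜_; _⊕_)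

open ≡-Reasoning

drop-square : ∀ x y → x · (y · y) ≡ x
drop-square x y = trans (cong (x ·_) (s*s≡+ y)) (*-identityʳ x)

exchange : ∀ {A B C D} → A · B ≡ C · D → C · B ≡ A · D
exchange {A} {B} {C} {D} AB≡CD = begin
  C · B               ≡⟨ sym (drop-square (C · B) D) ⟩
  (C · B) · (D · D)   ≡⟨ solve 3 (λ B C D → (C ⊕ B) ⊕ (D ⊕ D) ⊜ (C ⊕ D) ⊕ (D ⊕ B)) refl B C D ⟩
  (C · D) · (D · B)   ≡⟨ cong (_· (D · B)) (sym AB≡CD) ⟩
  (A · B) · (D · B)   ≡⟨ solve 3 (λ A B D → (A ⊕ B) ⊕ (D ⊕ B) ⊜ (A ⊕ D) ⊕ (B ⊕ B)) refl A B D ⟩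
  (A · D) · (B · B)   ≡⟨ drop-square (A · D) B ⟩
  A · D               ∎

odd-power : ∀ j c → suc (2 * j) ×ₛ c ≡ c
odd-power j c = begin
  c · ((j + (j + 0)) ×ₛ c)       ≡⟨ cong (λ i → c · ((j + i) ×ₛ c)) (+-identityʳ j) ⟩
  c · ((j + j) ×ₛ c)             ≡⟨ cong (c ·_) (×-homo-+ c j j) ⟩
  c · (j ×ₛ c · j ×ₛ c)          ≡⟨ drop-square c (j ×ₛ c) ⟩
  c                              ∎

two-agree : ∀ (x y z : Sign) → x ≡ y ⊎ x ≡ z ⊎ y ≡ z
two-agree s+ s+ _  = inj₁ refl
two-agree s- s- _  = inj₁ refl
two-agree s+ s- s+ = inj₂ (inj₁ refl)
two-agree s+ s- s- = inj₂ (inj₂ refl)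
two-agree s- s+ s+ = inj₂ (inj₂ refl)
two-agree s- s+ s- = inj₂ (inj₁ refl)

module NatSum = CommutativeMonoidSum +-0-commutativeMonoid
module SignProduct = CommutativeMonoidSum *-commutativeMonoid

ind : Bool → ℕ
ind b = if b then 1 else 0

count : ∀ {m} → (Fin m → Bool) → ℕ
count Q = NatSum.sum (ind ∘ Q)

∏[_]_ : ∀ {m} → (Fin m → Bool) → (Fin m → Sign) → Sign
∏[ Q ] F = SignProduct.sum (λ k → if Q k then F k else s+)

sum-ones : ∀ m → NatSum.sum {m} (λ _ → 1) ≡ m
sum-ones zero    = refl
sum-ones (suc m) = cong suc (sum-ones m)

count-none : ∀ {m} (Q : Fin m → Bool) → (∀ k → Q k ≡ false) → count Q ≡ 0
count-none {m} Q none = trans (NatSum.sum-cong-≗ {m} (cong ind ∘ none)) (NatSum.sum-replicate-zero m)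

count-single : ∀ {m} (j : Fin m) → count (λ k → does (k ≟ j)) ≡ 1
count-single {suc m} fzero    = cong suc (count-none {m} (λ k → does (fsuc k ≟ fzero)) (λ k → dec-false (fsuc k ≟ fzero) λ ()))
count-single {suc m} (fsuc j) = count-single j

∏-cong : ∀ {m} (Q : Fin m → Bool) {F F′ : Fin m → Sign} →
         (∀ k → Q k ≡ true → F k ≡ F′ k) → ∏[ Q ] F ≡ ∏[ Q ] F′
∏-cong Q {F} {F′} F≡F′ = SignProduct.sum-cong-≗ pointwise
  where
    pointwise : ∀ k → (if Q k then F k else s+) ≡ (if Q k then F′ k else s+)
    pointwise k with Q k in eq
    ... | true  = F≡F′ k eq
    ... | false = refl

∏-· : ∀ {m} (Q : Fin m → Bool) (F F′ : Fin m → Sign) →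
      ∏[ Q ] (λ k → F k · F′ k) ≡ ∏[ Q ] F · ∏[ Q ] F′
∏-· Q F F′ = trans (SignProduct.sum-cong-≗ pointwise) (SignProduct.∑-distrib-+ (λ k → if Q k then F k else s+) (λ k → if Q k then F′ k else s+))
  where
    pointwise : ∀ k → (if Q k then F k · F′ k else s+)
                      ≡ (if Q k then F k else s+) · (if Q k then F′ k else s+)
    pointwise k with Q k
    ... | true  = refl
    ... | false = refl

∏-const : ∀ {m} (Q : Fin m → Bool) (c : Sign) → ∏[ Q ] (λ _ → c) ≡ count Q ×ₛ c
∏-const {zero}  Q c = refl
∏-const {suc m} Q c with Q fzero
... | true  = cong (c ·_) (∏-const (Q ∘ fsuc) c)
... | false = ∏-const (Q ∘ fsuc) c

-- Involutions of Fin n: pairing and selectors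

module Involution {n : ℕ} (σ : Fin n → Fin n) (σ-invol : ∀ k → σ (σ k) ≡ k) where

  σ-perm : Permutation′ n
  σ-perm = permutation σ σ σ-invol σ-invol

  fixed below : Fin n → Bool
  fixed k = does (σ k ≟ k)
  below k = does (k <? σ k)

  trichotomy : ∀ k → ind (fixed k) + (ind (below k) + ind (below (σ k))) ≡ 1
  trichotomy k rewrite σ-invol k with <-cmp k (σ k)
  ... | tri< k<σk k≢σk σk≮k
    rewrite dec-false (σ k ≟ k) (k≢σk ∘ sym) | dec-true (k <? σ k) k<σk | dec-false (σ k <? k) σk≮k = refl
  ... | tri≈ k≮σk k≡σk σk≮k
    rewrite dec-true (σ k ≟ k) (sym k≡σk) | dec-false (k <? σ k) k≮σk | dec-false (σ k <? k) σk≮k = refl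
  ... | tri> k≮σk k≢σk σk<k
    rewrite dec-false (σ k ≟ k) (k≢σk ∘ sym) | dec-false (k <? σ k) k≮σk | dec-true (σ k <? k) σk<k = refl

  pairing : count fixed + 2 * count below ≡ n
  pairing = begin
    count fixed + 2 * count below
      ≡⟨ cong (λ c → count fixed + (count below + c)) (+-identityʳ (count below)) ⟩
    count fixed + (count below + count below)
      ≡⟨ cong (λ c → count fixed + (count below + c)) (NatSum.sum-permute (ind ∘ below) σ-perm) ⟩
    count fixed + (count below + count (below ∘ σ))
      ≡⟨ cong (count fixed +_) (sym (NatSum.∑-distrib-+ (ind ∘ below) (ind ∘ below ∘ σ))) ⟩
    count fixed + NatSum.sum (λ k → ind (below k) + ind (below (σ k)))
      ≡⟨ sym (NatSum.∑-distrib-+ (ind ∘ fixed) _) ⟩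
    NatSum.sum (λ k → ind (fixed k) + (ind (below k) + ind (below (σ k))))
      ≡⟨ NatSum.sum-cong-≗ {n} trichotomy ⟩
    NatSum.sum {n} (λ _ → 1)
      ≡⟨ sum-ones n ⟩
    n ∎

  count-below : ∀ {m} → (∀ k → σ k ≢ k) → n ≡ 2 * m → count below ≡ m
  count-below {m} no-fixed n≡2m = ℕ-*-cancelˡ-≡ (count below) m 2 (begin
    2 * count below                  ≡⟨ cong (_+ 2 * count below) (sym no-fixed-count) ⟩
    count fixed + 2 * count below    ≡⟨ pairing ⟩
    n                                ≡⟨ n≡2m ⟩
    2 * m                            ∎)
    where
      no-fixed-count : count fixed ≡ 0
      no-fixed-count = count-none fixed (λ k → dec-false (σ k ≟ k) (no-fixed k))

  below-flip : ∀ k → σ k ≢ k → below (σ k) ≡ not (below k)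
  below-flip k σk≢k rewrite σ-invol k with <-cmp k (σ k)
  ... | tri< k<σk _ σk≮k rewrite dec-true (k <? σ k) k<σk | dec-false (σ k <? k) σk≮k = refl
  ... | tri≈ _ k≡σk _ = contradiction (sym k≡σk) σk≢k
  ... | tri> k≮σk _ σk<k rewrite dec-false (k <? σ k) k≮σk | dec-true (σ k <? k) σk<k = refl

  -- A selector chooses one point from every 2-cycle.  For a σ-invariant F the
  -- product over the selected points does not depend on the selector: the
  -- involution τ swapping k and σ k where the selectors disagree carries
  -- one selection to the other.
  selector-independent : (Q Q′ : Fin n → Bool) →
    (∀ k → Q (σ k) ≡ not (Q k)) → (∀ k → Q′ (σ k) ≡ not (Q′ k)) →
    (F : Fin n → Sign) → (∀ k → F (σ k) ≡ F k) → ∏[ Q ] F ≡ ∏[ Q′ ] F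
  selector-independent Q Q′ Q-sel Q′-sel F F-inv = begin
    SignProduct.sum H         ≡⟨ SignProduct.sum-permute H τ-perm ⟩
    SignProduct.sum (H ∘ τ)   ≡⟨ SignProduct.sum-cong-≗ (sym ∘ moved) ⟩
    ∏[ Q′ ] F                 ∎
    where
      H : Fin n → Sign
      H k = if Q k then F k else s+

      agree : Fin n → Bool
      agree k = does (Q k ≟ᵇ Q′ k)

      agree-stable : ∀ k → agree (σ k) ≡ agree k
      agree-stable k with Q k ≟ᵇ Q′ k
      ... | yes p = dec-true (Q (σ k) ≟ᵇ Q′ (σ k))
                      (trans (Q-sel k) (trans (cong not p) (sym (Q′-sel k))))
      ... | no ¬p = dec-false (Q (σ k) ≟ᵇ Q′ (σ k))
                      (λ q → ¬p (not-injective (trans (sym (Q-sel k)) (trans q (Q′-sel k)))))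

      τ : Fin n → Fin n
      τ k = if agree k then k else σ k

      τ-invol : ∀ k → τ (τ k) ≡ k
      τ-invol k with agree k in eq
      ... | true  rewrite eq = refl
      ... | false rewrite agree-stable k | eq = σ-invol k

      τ-perm : Permutation′ n
      τ-perm = permutation τ τ τ-invol τ-invol

      moved : ∀ k → (if Q′ k then F k else s+) ≡ H (τ k)
      moved k with Q k ≟ᵇ Q′ k
      ... | yes p = cong (λ b → if b then F k else s+) (sym p)
      ... | no ¬p rewrite Q-sel k | F-inv k | ¬-not (¬p ∘ sym) = refl

-- Groups of even order contain an involution

toGroup : ∀ {n} → FinGroup n → Group 0ℓ 0ℓ
toGroup {n} G = record
  { Carrier = Fin n
  ; _≈_     = _≡_
  ; _∙_     = _∙_
  ; ε       = e
  ; _⁻¹     = inv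
  ; isGroup = record
    { isMonoid = record
      { isSemigroup = record
        { isMagma = record { isEquivalence = isEquivalence ; ∙-cong = cong₂ _∙_ }
        ; assoc   = assoc }
      ; identity = idˡ , idʳ }
    ; inverse = invˡ , invʳ
    ; ⁻¹-cong = cong inv } }
  where open FinGroup G

module _ {n : ℕ} (G : FinGroup n) where
  open FinGroup G

  -- If no k ≠ e satisfies k⁻¹ = k, then e is the only fixed point of
  -- k ↦ k⁻¹ and the pairing count makes |G| odd.
  involution-exists : ∀ {m} → n ≡ 2 * m → Σ (Fin n) λ a → a ∙ a ≡ e × a ≢ e
  involution-exists {m} n≡2m with any? (λ k → ¬? (k ≟ e) ×-dec (inv k ≟ k))
  ... | yes (a , a≢e , a⁻¹≡a) = a , trans (cong (a ∙_) (sym a⁻¹≡a)) (invʳ a) , a≢e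
  ... | no none = contradiction odd-order (even≢odd m (count below))
    where
      open GroupProperties (toGroup G) using (ε⁻¹≈ε; ⁻¹-involutive)
      open Involution inv ⁻¹-involutive using (fixed; below; pairing)

      only-e-fixed : ∀ k → fixed k ≡ does (k ≟ e)
      only-e-fixed k with k ≟ e
      ... | yes refl = dec-true (inv e ≟ e) ε⁻¹≈ε
      ... | no k≢e   = dec-false (inv k ≟ k) (λ k⁻¹≡k → none (k , k≢e , k⁻¹≡k))

      odd-order : 2 * m ≡ suc (2 * count below)
      odd-order = begin
        2 * m                           ≡⟨ sym n≡2m ⟩
        n                               ≡⟨ sym pairing ⟩
        count fixed + 2 * count below   ≡⟨ cong (_+ 2 * count below) one-fixed ⟩
        suc (2 * count below)           ∎
        where
          one-fixed : count fixed ≡ 1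
          one-fixed = trans (NatSum.sum-cong-≗ (cong ind ∘ only-e-fixed)) (count-single e)

-- Cocycles and the extension groups E_ψ

module _ {n : ℕ} (G : FinGroup n) where
  open FinGroup G

  cocycle-unitˡ : ∀ {ψ} → IsCocycle G ψ → ∀ k → ψ e k ≡ s+
  cocycle-unitˡ {ψ} (cocycle , ψee) k = trans (sym ψee≡ψek) ψee
    where
      ψee≡ψek : ψ e e ≡ ψ e k
      ψee≡ψek = *-cancelʳ-≡ (ψ e k) (ψ e e) (ψ e k) (begin
        ψ e e · ψ e k          ≡⟨ cong (λ z → ψ e e · ψ z k) (sym (idˡ e)) ⟩
        ψ e e · ψ (e ∙ e) k    ≡⟨ cocycle e e k ⟩
        ψ e (e ∙ k) · ψ e k    ≡⟨ cong (λ z → ψ e z · ψ e k) (idˡ k) ⟩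
        ψ e k · ψ e k          ∎)

  cocycle-unitʳ : ∀ {ψ} → IsCocycle G ψ → ∀ k → ψ k e ≡ s+
  cocycle-unitʳ {ψ} (cocycle , ψee) k = trans ψke≡ψee ψee
    where
      ψke≡ψee : ψ k e ≡ ψ e e
      ψke≡ψee = *-cancelˡ-≡ (ψ k e) (ψ k e) (ψ e e) (begin
        ψ k e · ψ k e          ≡⟨ cong (λ z → ψ k e · ψ z e) (sym (idʳ k)) ⟩
        ψ k e · ψ (k ∙ e) e    ≡⟨ cocycle k e e ⟩
        ψ k (e ∙ e) · ψ e e    ≡⟨ cong (λ z → ψ k z · ψ e e) (idˡ e) ⟩
        ψ k e · ψ e e          ∎)

  product-cocycle : ∀ {ψ₁ ψ₂} → IsCocycle G ψ₁ → IsCocycle G ψ₂ →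
                    IsCocycle G (λ g h → ψ₁ g h · ψ₂ g h)
  product-cocycle {ψ₁} {ψ₂} (cocycle₁ , norm₁) (cocycle₂ , norm₂) = cocycle , cong₂ _·_ norm₁ norm₂
    where
      cocycle : ∀ g h k → (ψ₁ g h · ψ₂ g h) · (ψ₁ (g ∙ h) k · ψ₂ (g ∙ h) k)
                        ≡ (ψ₁ g (h ∙ k) · ψ₂ g (h ∙ k)) · (ψ₁ h k · ψ₂ h k)
      cocycle g h k = begin
        (ψ₁ g h · ψ₂ g h) · (ψ₁ (g ∙ h) k · ψ₂ (g ∙ h) k)   ≡⟨ interchange (ψ₁ g h) _ (ψ₁ (g ∙ h) k) _ ⟩
        (ψ₁ g h · ψ₁ (g ∙ h) k) · (ψ₂ g h · ψ₂ (g ∙ h) k)   ≡⟨ cong₂ _·_ (cocycle₁ g h k) (cocycle₂ g h k) ⟩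
        (ψ₁ g (h ∙ k) · ψ₁ h k) · (ψ₂ g (h ∙ k) · ψ₂ h k)   ≡⟨ interchange (ψ₁ g (h ∙ k)) _ (ψ₂ g (h ∙ k)) _ ⟩
        (ψ₁ g (h ∙ k) · ψ₂ g (h ∙ k)) · (ψ₁ h k · ψ₂ h k)   ∎

  coboundary⇒EIso : (ψ₁ ψ₂ : Fin n → Fin n → Sign) (φ : Fin n → Sign) →
    (∀ x y → (ψ₁ x y · ψ₂ x y) · φ (x ∙ y) ≡ φ x · φ y) → EIso G ψ₁ ψ₂
  coboundary⇒EIso ψ₁ ψ₂ φ coboundary = twist , (injective , surjective) , homomorphism
    where
      twist : Sign × Fin n → Sign × Fin n
      twist (u , g) = (u · φ g , g)

      injective : ∀ {x y} → twist x ≡ twist y → x ≡ y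
      injective {u , g} {v , h} eq with cong proj₂ eq
      ... | refl = cong (_, g) (*-cancelʳ-≡ (φ g) u v (cong proj₁ eq))

      surjective : ∀ y → Σ (Sign × Fin n) λ x → ∀ {z} → z ≡ x → twist z ≡ y
      surjective (v , h) = (v · φ h , h) , λ { refl →
        cong (_, h) (trans (*-assoc v (φ h) (φ h)) (drop-square v (φ h))) }

      homomorphism : ∀ x y → twist (Emul G ψ₁ x y) ≡ Emul G ψ₂ (twist x) (twist y)
      homomorphism (u , g) (v , h) = cong (_, g ∙ h) (begin
        ((u · v) · P) · φ (g ∙ h)               ≡⟨ sym (drop-square _ Q) ⟩
        (((u · v) · P) · φ (g ∙ h)) · (Q · Q)    ≡⟨ solve 5 (λ u v P Q φgh → (((u ⊕ v) ⊕ P) ⊕ φgh) ⊕ (Q ⊕ Q)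
                                                       ⊜ ((u ⊕ v) ⊕ ((P ⊕ Q) ⊕ φgh)) ⊕ Q) refl u v P Q (φ (g ∙ h)) ⟩
        ((u · v) · ((P · Q) · φ (g ∙ h))) · Q    ≡⟨ cong (λ s → ((u · v) · s) · Q) (coboundary g h) ⟩
        ((u · v) · (φ g · φ h)) · Q              ≡⟨ cong (_· Q) (interchange u v (φ g) (φ h)) ⟩
        ((u · φ g) · (v · φ h)) · Q              ∎)
        where
          P = ψ₁ g h
          Q = ψ₂ g h

-- The transversal of H = {e, a} and the transfer of a cocycle

module Transversal {n : ℕ} (G : FinGroup n) (j : ℕ) (order : n ≡ 2 * suc (2 * j))
                   (a : Fin n) (a∙a≡e : FinGroup._∙_ G a a ≡ FinGroup.e G)
                   (a≢e : a ≢ FinGroup.e G) where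
  open FinGroup G
  open GroupProperties (toGroup G) using (∙-cancelˡ; \\-leftDividesˡ; \\-leftDividesʳ)

  ·a-invol : ∀ k → (k ∙ a) ∙ a ≡ k
  ·a-invol k = trans (assoc k a a) (trans (cong (k ∙_) a∙a≡e) (idʳ k))

  ·a-moves : ∀ k → k ∙ a ≢ k
  ·a-moves k k∙a≡k = a≢e (∙-cancelˡ k a e (trans k∙a≡k (sym (idʳ k))))

  open Involution (_∙ a) ·a-invol using (below; below-flip; count-below; selector-independent)

  -- T = {k | R k}: the smaller element of each coset {k, k·a}
  R : Fin n → Bool
  R = below

  R-flip : ∀ k → R (k ∙ a) ≡ not (R k)
  R-flip k = below-flip k (·a-moves k)

  count-R : count R ≡ suc (2 * j)
  count-R = count-below ·a-moves order

  InH : Fin n → Set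
  InH h = h ≡ e ⊎ h ≡ a

  H-closed : ∀ {h h′} → InH h → InH h′ → InH (h ∙ h′)
  H-closed {h′ = h′} (inj₁ refl) h′∈H = subst InH (sym (idˡ h′)) h′∈H
  H-closed (inj₂ refl) (inj₁ refl) = inj₂ (idʳ a)
  H-closed (inj₂ refl) (inj₂ refl) = inj₁ a∙a≡e

  ρ η : Fin n → Fin n
  ρ k with R k
  ... | true  = k
  ... | false = k ∙ a
  η k with R k
  ... | true  = e
  ... | false = a

  ρ∙η : ∀ k → ρ k ∙ η k ≡ k
  ρ∙η k with R k
  ... | true  = idʳ k
  ... | false = ·a-invol k

  ρ∈T : ∀ k → R (ρ k) ≡ true
  ρ∈T k with R k in eq
  ... | true  = eq
  ... | false = trans (R-flip k) (cong not eq)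

  η∈H : ∀ k → InH (η k)
  η∈H k with R k
  ... | true  = inj₁ refl
  ... | false = inj₂ refl

  factor-unique : ∀ {r h} → R r ≡ true → InH h → ρ (r ∙ h) ≡ r × η (r ∙ h) ≡ h
  factor-unique {r} r∈T (inj₁ refl) rewrite idʳ r | r∈T = refl , refl
  factor-unique {r} r∈T (inj₂ refl) rewrite R-flip r | r∈T = ·a-invol r , refl

  ρ-on-T : ∀ k → R k ≡ true → ρ k ≡ k
  ρ-on-T k k∈T rewrite k∈T = refl

  ρ-invariant : ∀ k → ρ (k ∙ a) ≡ ρ k
  ρ-invariant k = begin
    ρ (k ∙ a)               ≡⟨ cong (λ z → ρ (z ∙ a)) (sym (ρ∙η k)) ⟩
    ρ ((ρ k ∙ η k) ∙ a)     ≡⟨ cong ρ (assoc (ρ k) (η k) a) ⟩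
    ρ (ρ k ∙ (η k ∙ a))     ≡⟨ proj₁ (factor-unique (ρ∈T k) (H-closed (η∈H k) (inj₂ refl))) ⟩
    ρ k                     ∎

  factor-product : ∀ x k → ρ (x ∙ k) ≡ ρ (x ∙ ρ k) × η (x ∙ k) ≡ η (x ∙ ρ k) ∙ η k
  factor-product x k =
    subst (λ z → ρ z ≡ r × η z ≡ h ∙ η k) factored
          (factor-unique (ρ∈T (x ∙ ρ k)) (H-closed (η∈H (x ∙ ρ k)) (η∈H k)))
    where
      r = ρ (x ∙ ρ k)
      h = η (x ∙ ρ k)
      factored : r ∙ (h ∙ η k) ≡ x ∙ k
      factored = begin
        r ∙ (h ∙ η k)     ≡⟨ sym (assoc r h (η k)) ⟩
        (r ∙ h) ∙ η k     ≡⟨ cong (_∙ η k) (ρ∙η (x ∙ ρ k)) ⟩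
        (x ∙ ρ k) ∙ η k   ≡⟨ assoc x (ρ k) (η k) ⟩
        x ∙ (ρ k ∙ η k)   ≡⟨ cong (x ∙_) (ρ∙η k) ⟩
        x ∙ k             ∎

  -- Left translation by y permutes the cosets, so it does not change the
  -- product over T of a function constant on cosets: y·T is again a
  -- transversal, selected by R′.
  ∏-translate : ∀ y (F : Fin n → Sign) → (∀ k → F (k ∙ a) ≡ F k) →
                ∏[ R ] (F ∘ (y ∙_)) ≡ ∏[ R ] F
  ∏-translate y F F-inv = begin
    ∏[ R ] (F ∘ (y ∙_))            ≡⟨ SignProduct.sum-cong-≗ translate ⟩
    SignProduct.sum (H′ ∘ (y ∙_))  ≡⟨ sym (SignProduct.sum-permute H′ y-perm) ⟩
    ∏[ R′ ] F                      ≡⟨ selector-independent R′ R R′-flip R-flip F F-inv ⟩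
    ∏[ R ] F                       ∎
    where
      R′ : Fin n → Bool
      R′ k = R (inv y ∙ k)

      R′-flip : ∀ k → R′ (k ∙ a) ≡ not (R′ k)
      R′-flip k = trans (cong R (sym (assoc (inv y) k a))) (R-flip (inv y ∙ k))

      H′ : Fin n → Sign
      H′ k = if R′ k then F k else s+

      translate : ∀ k → (if R k then F (y ∙ k) else s+) ≡ H′ (y ∙ k)
      translate k = cong (λ z → if R z then F (y ∙ k) else s+) (sym (\\-leftDividesʳ y k))

      y-perm : Permutation′ n
      y-perm = permutation (y ∙_) (inv y ∙_) (\\-leftDividesˡ y) (\\-leftDividesʳ y)

  -- The transfer of a cocycle χ with χ(a,a) = + is a cochain φ whose
  -- coboundary is χ.
  module Transfer (χ : Fin n → Fin n → Sign) (χ-cocycle : IsCocycle G χ) (χaa : χ a a ≡ s+) where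

    χ-on-H : ∀ {h h′} → InH h → InH h′ → χ h h′ ≡ s+
    χ-on-H (inj₁ refl) _           = cocycle-unitˡ G {χ} χ-cocycle _
    χ-on-H (inj₂ refl) (inj₁ refl) = cocycle-unitʳ G {χ} χ-cocycle a
    χ-on-H (inj₂ refl) (inj₂ refl) = χaa

    f : Fin n → Fin n → Sign
    f x k = χ x k · χ (ρ (x ∙ k)) (η (x ∙ k))

    φ : Fin n → Sign
    φ x = ∏[ R ] f x

    f-cocycle : ∀ x y k → χ x y · f (x ∙ y) k ≡ f x (ρ (y ∙ k)) · f y k
    f-cocycle x y k = begin
      χ x y · (χ (x ∙ y) k · χ (ρ ((x ∙ y) ∙ k)) (η ((x ∙ y) ∙ k)))
        ≡⟨ cong (λ z → P · (Q · z)) (cong₂ χ ρ-xyk η-xyk) ⟩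
      P · (Q · V)          ≡⟨ sym (*-assoc P Q V) ⟩
      (P · Q) · V          ≡⟨ cong₂ _·_ c₁ (sym c₃) ⟩
      (C · S) · (U · B)    ≡⟨ solve 4 (λ C S U B → (C ⊕ S) ⊕ (U ⊕ B) ⊜ (C ⊕ B) ⊕ (S ⊕ U)) refl C S U B ⟩
      (C · B) · (S · U)    ≡⟨ cong (_· (S · U)) (exchange {A} {B} {C} {D} c₂) ⟩
      (A · D) · (S · U)    ≡⟨ solve 4 (λ A D S U → (A ⊕ D) ⊕ (S ⊕ U) ⊜ (A ⊕ U) ⊕ (S ⊕ D)) refl A D S U ⟩
      (A · U) · (S · D)    ∎
      where
        -- y·k = r·h and x·r = r₂·h₂, hence (x·y)·k = r₂·(h₂·h)
        r  = ρ (y ∙ k)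
        h  = η (y ∙ k)
        r₂ = ρ (x ∙ r)
        h₂ = η (x ∙ r)
        ρ-xyk : ρ ((x ∙ y) ∙ k) ≡ r₂
        ρ-xyk = trans (cong ρ (assoc x y k)) (proj₁ (factor-product x (y ∙ k)))
        η-xyk : η ((x ∙ y) ∙ k) ≡ h₂ ∙ h
        η-xyk = trans (cong η (assoc x y k)) (proj₂ (factor-product x (y ∙ k)))
        P = χ x y
        Q = χ (x ∙ y) k
        V = χ r₂ (h₂ ∙ h)
        C = χ x (y ∙ k)
        S = χ y k
        U = χ r₂ h₂
        B = χ (x ∙ r) h
        A = χ x r
        D = χ r h
        c₁ : P · Q ≡ C · S
        c₁ = proj₁ χ-cocycle x y k
        c₂ : A · B ≡ C · D
        c₂ = trans (proj₁ χ-cocycle x r h) (cong (λ z → χ x z · D) (ρ∙η (y ∙ k)))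
        c₃ : U · B ≡ V
        c₃ = begin
          U · B                   ≡⟨ cong (λ z → U · χ z h) (sym (ρ∙η (x ∙ r))) ⟩
          U · χ (r₂ ∙ h₂) h       ≡⟨ proj₁ χ-cocycle r₂ h₂ h ⟩
          V · χ h₂ h              ≡⟨ cong (V ·_) (χ-on-H (η∈H (x ∙ r)) (η∈H (y ∙ k))) ⟩
          V · s+                  ≡⟨ *-identityʳ V ⟩
          V                       ∎

    ∏-odd : ∀ c → ∏[ R ] (λ _ → c) ≡ c
    ∏-odd c = trans (∏-const R c) (trans (cong (_×ₛ c) count-R) (odd-power j c))

    -- multiply the pointwise identity over T; the factor χ(x,y) occurs m times
    coboundary : ∀ x y → χ x y · φ (x ∙ y) ≡ φ x · φ y
    coboundary x y = begin
      χ x y · φ (x ∙ y)                          ≡⟨ cong (_· φ (x ∙ y)) (sym (∏-odd (χ x y))) ⟩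
      ∏[ R ] (λ _ → χ x y) · φ (x ∙ y)            ≡⟨ sym (∏-· R (λ _ → χ x y) (f (x ∙ y))) ⟩
      ∏[ R ] (λ k → χ x y · f (x ∙ y) k)          ≡⟨ ∏-cong R (λ k _ → f-cocycle x y k) ⟩
      ∏[ R ] (λ k → f x (ρ (y ∙ k)) · f y k)      ≡⟨ ∏-· R (λ k → f x (ρ (y ∙ k))) (f y) ⟩
      ∏[ R ] (λ k → f x (ρ (y ∙ k))) · φ y        ≡⟨ cong (_· φ y) (∏-translate y (f x ∘ ρ) (cong (f x) ∘ ρ-invariant)) ⟩
      ∏[ R ] (f x ∘ ρ) · φ y                      ≡⟨ cong (_· φ y) (∏-cong R (λ k k∈T → cong (f x) (ρ-on-T k k∈T))) ⟩
      φ x · φ y                                   ∎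

  corner-determines-E : (ψ₁ ψ₂ : Fin n → Fin n → Sign) → IsCocycle G ψ₁ → IsCocycle G ψ₂ →
                        ψ₁ a a ≡ ψ₂ a a → EIso G ψ₁ ψ₂
  corner-determines-E ψ₁ ψ₂ cocycle₁ cocycle₂ same-corner = coboundary⇒EIso G ψ₁ ψ₂ φ coboundary
    where
      open Transfer (λ g h → ψ₁ g h · ψ₂ g h) (product-cocycle G {ψ₁} {ψ₂} cocycle₁ cocycle₂)
                    (trans (cong (_· ψ₂ a a) same-corner) (s*s≡+ (ψ₂ a a)))

ord-even : ∀ t → 4 * t + 2 ≡ 2 * suc (2 * t)
ord-even = solve-∀

corollary1 : (t : ℕ) → t ≥ 1 → (G : FinGroup (ord t)) →
    (ψ₁ ψ₂ ψ₃ : Fin (ord t) → Fin (ord t) → Sign) →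
    QuasiOrthogonal t G ψ₁ → QuasiOrthogonal t G ψ₂ → QuasiOrthogonal t G ψ₃ →
    EIso G ψ₁ ψ₂ ⊎ EIso G ψ₁ ψ₃ ⊎ EIso G ψ₂ ψ₃
corollary1 t _ G ψ₁ ψ₂ ψ₃ (cocycle₁ , _) (cocycle₂ , _) (cocycle₃ , _) =
  map (corner-determines-E ψ₁ ψ₂ cocycle₁ cocycle₂)
      (map (corner-determines-E ψ₁ ψ₃ cocycle₁ cocycle₃) (corner-determines-E ψ₂ ψ₃ cocycle₂ cocycle₃))
      (two-agree (ψ₁ a a) (ψ₂ a a) (ψ₃ a a))
  where
    involution = involution-exists G {suc (2 * t)} (ord-even t)
    a = proj₁ involution
    open Transversal G t (ord-even t) a (proj₁ (proj₂ involution)) (proj₂ (proj₂ involution))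
      using (corner-determines-E)
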